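{- Let $p$ be an odd prime and $\lambda$ a BG-partition. The following are equivalent: (1) $\varepsilon^*_\lambda=0$; (2) $a^*_\lambda$ is even; (3) $\mathrm{Rim}^*_p(\lambda)$ contains no diagonal node; (4) $p\mid a^*_\lambda$.
   Context: A partition is a weakly decreasing sequence $\lambda=(\lambda_1\geq\lambda_2\geq\cdots)$ of nonnegative integers with finitely many nonzero terms; $\ell(\lambda)$ is the number of nonzero parts; $[\lambda]=\{(i,j):i\geq1,\ 1\leq j\leq\lambda_i\}$ (rows downward); $\lambda'$ is the conjugate; self-conjugate means $\lambda=\lambda'$. $k(\lambda)=\max\{i:\lambda_i\geq i\}$; diagonal nodes are $(i,i)$, $1\leq i\leq k(\lambda)$; $h^\lambda_{ij}=\lambda_i+\lambda'_j-i-j+1$. A BG-partition is a self-conjugate $\lambda$ with $p\nmid h^\lambda_{ii}$ for all $1\leq i\leq k(\lambda)$. $p$-rim: the rim is the set of $(i,j)\in[\lambda]$ with $(i+1,j+1)\notin[\lambda]$. Label rim nodes $1,2,\dots$ along the rim from $(1,\lambda_1)$ towards the bottom-left. The first $p$-segment is the rim nodes with labels $\leq p$. If the last node of a $p$-segment is in row $i<\ell(\lambda)$ and $l$ is the smallest label of a rim node in row $i+1$, the next $p$-segment is the rim nodes with labels $l,\dots,l+p-1$ (those which exist); continue until the last row. $\mathrm{Rim}_p(\lambda)$ is the union of the $p$-segments. For self-conjugate $\lambda$: $U_\lambda=\{(i,j)\in\mathrm{Rim}_p(\lambda):i\leq j\}$, $L_\lambda=\{(j,i):(i,j)\in U_\lambda\}$,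 $\mathrm{Rim}^*_p(\lambda)=U_\lambda\cup L_\lambda$, $a^*_\lambda=\#\mathrm{Rim}^*_p(\lambda)$, $\varepsilon^*_\lambda=a^*_\lambda\bmod 2$. -}

module Defs where

open import Data.Nat using (ℕ; zero; suc; _+_; _∸_; _⊔_; _≤_; _<_; _<?_; _≤?_; _≡ᵇ_)
open import Data.Nat using (_≟_)
open import Data.Nat.Divisibility using (_∣_)
open import Data.Bool using (Bool; true; false; if_then_else_)
open import Data.Product using (_×_; _,_; proj₁; swap)
open import Data.Product.Properties using () renaming (≡-dec to ×-≡-dec)
open import Data.Maybe using (Maybe; just; nothing)
open import Data.List using (List; []; _∷_; length; map; upTo; concatMap; take; drop; filter; deduplicate; _++_; reverse; last; foldr)
open import Data.List.Membership.Propositional using (_∈_)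
open import Data.List.Relation.Unary.All using (All)
open import Data.List.Relation.Unary.Linked using (Linked)
open import Relation.Nullary using (¬_)
open import Relation.Nullary.Decidable using (⌊_⌋)
open import Relation.Binary.PropositionalEquality using (_≡_)

IsPartition : List ℕ → Set
IsPartition λs = Linked (λ a b → b ≤ a) λs × All (λ a → 1 ≤ a) λs

-- λ_i (rows are 1-indexed; λ_i = 0 for i > ℓ(λ); index 0 unused, set to 0)
part : List ℕ → ℕ → ℕ
part []       _             = 0
part (x ∷ xs) zero          = 0
part (x ∷ xs) (suc zero)    = x
part (x ∷ xs) (suc (suc i)) = part xs (suc i)

len : List ℕ → ℕ
len = length

conjPart : List ℕ → ℕ → ℕ
conjPart λs j = length (filter (λ a → j ≤? a) λs)

conjugate : List ℕ → List ℕ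
conjugate λs = map (λ j → conjPart λs (suc j)) (upTo (part λs 1))

SelfConjugate : List ℕ → Set
SelfConjugate λs = conjugate λs ≡ λs

-- k(λ) = max { i : λ_i ≥ i }  (0 if there is no such i)
kOf : List ℕ → ℕ
kOf λs = foldr (λ i acc → if ⌊ i ≤? part λs i ⌋ then i ⊔ acc else acc) 0
               (map suc (upTo (len λs)))

hook : List ℕ → ℕ → ℕ → ℕ
hook λs i j = (part λs i + conjPart λs j + 1) ∸ (i + j)

IsBG : ℕ → List ℕ → Set
IsBG p λs = SelfConjugate λs ×
  (∀ i → 1 ≤ i → i ≤ kOf λs → ¬ (p ∣ hook λs i i))

Node : Set
Node = ℕ × ℕ

-- hi, hi−1, …, lo  (empty if hi < lo)
rangeDown : ℕ → ℕ → List ℕ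
rangeDown hi lo = map (λ t → lo + t) (reverse (upTo (suc hi ∸ lo)))

-- rim nodes in row i, from right to left: (i,j) with max(1,λ_{i+1}) ≤ j ≤ λ_i
-- ((i,j) is in the rim iff (i+1,j+1) ∉ [λ] iff j ≥ λ_{i+1})
rimRow : List ℕ → ℕ → List Node
rimRow λs i = map (λ j → (i , j)) (rangeDown (part λs i) (part λs (suc i) ⊔ 1))

rows : ℕ → List ℕ
rows r = map suc (upTo r)

-- the rim, listed in order from (1,λ₁) towards the bottom-left;
-- the node at list position t (0-based) has label t+1
rim : List ℕ → List Node
rim λs = concatMap (rimRow λs) (rows (len λs))

firstLabel : List ℕ → ℕ → ℕ
firstLabel λs r = suc (length (concatMap (rimRow λs) (rows (r ∸ 1))))

-- the rim nodes with labels l, …, l+p−1 (those which exist)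
segment : ℕ → List ℕ → ℕ → List Node
segment p λs l = take p (drop (l ∸ 1) (rim λs))

segmentsFrom : ℕ → List ℕ → ℕ → ℕ → List Node
segmentsFrom p λs zero     l = []
segmentsFrom p λs (suc f) l with last (segment p λs l)
... | nothing      = segment p λs l
... | just (i , _) =
  if ⌊ i <? len λs ⌋
  then segment p λs l ++ segmentsFrom p λs f (firstLabel λs (suc i))
  else segment p λs l

rimP : ℕ → List ℕ → List Node
rimP p λs = segmentsFrom p λs (suc (length (rim λs))) 1

Uλ : ℕ → List ℕ → List Node
Uλ p λs = filter (λ n → proj₁ n ≤? Data.Product.proj₂ n) (rimP p λs)

Lλ : ℕ → List ℕ → List Node
Lλ p λs = map swap (Uλ p λs)

-- Rim*_p(λ) = U_λ ∪ L_λ  (duplicates removed, so its length is the cardinality)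
rimStar : ℕ → List ℕ → List Node
rimStar p λs = deduplicate (×-≡-dec _≟_ _≟_) (Uλ p λs ++ Lλ p λs)

aStar : ℕ → List ℕ → ℕ
aStar p λs = length (rimStar p λs)

epsStar : ℕ → List ℕ → ℕ
epsStar p λs = aStar p λs Data.Nat.% 2

NoDiagonal : ℕ → List ℕ → Set
NoDiagonal p λs = ∀ i → 1 ≤ i → i ≤ kOf λs → ¬ ((i , i) ∈ rimStar p λs)

module Submission where

-- Let k = k(λ).  Read from (1,λ₁), the rim runs strictly above the diagonal up
-- to (k,k) and strictly below it afterwards; from row t ≤ k it has λ_t − t
-- nodes before (k,k).  The p-segments are consecutive chunks of the rim, so
-- U_λ (their nodes on or above the diagonal) either consists of whole segments
-- strictly above the diagonal (p ∣ |U_λ|), or is Y ++ [(k,k)] where the last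
-- segment starts in a row t with λ_t − t = |Y|, so that 2|Y| + 1 = h_tt is prime
-- to p ('UpperShape').

open import Defs
open import Data.Nat using (ℕ)
open import Data.Nat.Divisibility using (_∣_)
open import Data.Nat.Primality using (Prime)
open import Data.List using (List)
open import Data.Product using (_×_)
open import Function.Bundles using (_⇔_)
open import Relation.Nullary using (¬_)
open import Relation.Binary.PropositionalEquality using (_≡_)

open import Data.Nat
open import Data.Nat.Properties
open import Data.Nat.Divisibility using (_∣0; ∣-refl; ∣m∣n⇒∣m+n; ∣m+n∣m⇒∣n; divides; ∣1⇒≡1; m%n≡0⇔n∣m)
open import Data.Nat.Tactic.RingSolver using (solve-∀)
open import Data.Bool using (if_then_else_)
open import Data.Empty using (⊥-elim)
open import Data.Maybe using (Maybe; just; nothing)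
open import Data.Product using (_,_; proj₁; proj₂; ∃; swap)
open import Data.Product.Properties using () renaming (≡-dec to ×-≡-dec)
open import Data.Sum using (_⊎_; inj₁; inj₂)
open import Data.List using ([]; _∷_; [_]; length; map; applyUpTo; applyDownFrom; concatMap; take; drop; filter; _++_; last; foldr; deduplicate)
open import Data.List.Properties
open import Data.List.Membership.Propositional using (_∈_)
open import Data.List.Membership.Propositional.Properties using (∈-map⁻; ∈-++⁻; ∈-++⁺ˡ; ∈-++⁺ʳ; deduplicate-∈⇔)
open import Data.List.Membership.Propositional.Properties.WithK using (unique∧set⇒bag)
open import Data.List.Relation.Unary.Any using (here; there)
open import Data.List.Relation.Unary.All as All using (All; []; _∷_)
import Data.List.Relation.Unary.All.Properties as AllP
open import Data.List.Relation.Unary.AllPairs as AllPairs using (AllPairs; []; _∷_)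
import Data.List.Relation.Unary.AllPairs.Properties as AllPairsP
open import Data.List.Relation.Unary.Linked using (Linked; _∷_)
open import Data.List.Relation.Unary.Unique.Propositional using (Unique)
import Data.List.Relation.Unary.Unique.Propositional.Properties as UniqueP
import Data.List.Relation.Unary.Unique.DecPropositional.Properties as UniqueDecP
open import Data.List.Relation.Binary.Permutation.Propositional.Properties using (↭-length)
open import Data.List.Relation.Binary.BagAndSetEquality using (∼bag⇒↭)
open import Function using (id; _∘_)
open import Function.Bundles using (mk⇔; Equivalence)
open import Relation.Binary.Definitions using (DecidableEquality)
open import Relation.Binary.PropositionalEquality using (refl; sym; trans; cong; cong₂; subst; subst₂; module ≡-Reasoning)
open import Relation.Nullary using (Dec; yes; no)
open import Relation.Nullary.Decidable using (⌊_⌋)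
open import Relation.Unary using (Decidable)

drop-length-++ : ∀ {A : Set} (xs ys : List A) → drop (length xs) (xs ++ ys) ≡ ys
drop-length-++ []       ys = refl
drop-length-++ (x ∷ xs) ys = drop-length-++ xs ys

take-++ˡ : ∀ {A : Set} n (xs ys : List A) → n ≤ length xs → take n (xs ++ ys) ≡ take n xs
take-++ˡ zero    xs       ys _         = refl
take-++ˡ (suc n) (x ∷ xs) ys (s≤s n≤) = cong (x ∷_) (take-++ˡ n xs ys n≤)

take-++ʳ : ∀ {A : Set} n (xs ys : List A) → length xs ≤ n →
           take n (xs ++ ys) ≡ xs ++ take (n ∸ length xs) ys
take-++ʳ n       []       ys _         = refl
take-++ʳ (suc n) (x ∷ xs) ys (s≤s ≤n) = cong (x ∷_) (take-++ʳ n xs ys ≤n)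

last-∈ : ∀ {A : Set} {x : A} xs → last xs ≡ just x → x ∈ xs
last-∈ (y ∷ [])     refl = here refl
last-∈ (y ∷ z ∷ xs) eq   = there (last-∈ (z ∷ xs) eq)

last-sorted : ∀ {A : Set} {R : A → A → Set} {x z : A} xs → AllPairs R xs →
              last xs ≡ just z → x ∈ xs → x ≡ z ⊎ R x z
last-sorted (y ∷ [])     _            refl (here refl) = inj₁ refl
last-sorted (y ∷ z ∷ xs) (y<rest ∷ _) eq   (here refl) = inj₂ (All.lookup y<rest (last-∈ (z ∷ xs) eq))
last-sorted (y ∷ z ∷ xs) (_ ∷ sorted) eq   (there x∈) = last-sorted (z ∷ xs) sorted eq x∈

last-++-∷ : ∀ {A : Set} (xs : List A) y ys {z} → last (xs ++ y ∷ ys) ≡ just z → z ≡ y ⊎ z ∈ ys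
last-++-∷ []           y []       refl = inj₁ refl
last-++-∷ []           y (w ∷ ys) eq   = inj₂ (last-∈ (w ∷ ys) eq)
last-++-∷ (x ∷ [])     y ys       eq   = last-++-∷ [] y ys eq
last-++-∷ (x ∷ x′ ∷ xs) y ys      eq   = last-++-∷ (x′ ∷ xs) y ys eq

AllPairs-++⁻ˡ : ∀ {A : Set} {R : A → A → Set} xs {ys} → AllPairs R (xs ++ ys) → AllPairs R xs
AllPairs-++⁻ˡ []       _                 = []
AllPairs-++⁻ˡ (x ∷ xs) (x~rest ∷ rest) = AllP.++⁻ˡ xs x~rest ∷ AllPairs-++⁻ˡ xs rest

∈-++-absorb : ∀ {A : Set} {z : A} xs ys zs → (∀ {w} → w ∈ zs → w ∈ xs) →
              z ∈ xs ++ ys ++ zs ⇔ z ∈ xs ++ ys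
∈-++-absorb {z = z} xs ys zs zs⊆xs = mk⇔ to from
  where
  to : z ∈ xs ++ ys ++ zs → z ∈ xs ++ ys
  to z∈ with ∈-++⁻ xs z∈
  ... | inj₁ z∈xs = ∈-++⁺ˡ z∈xs
  ... | inj₂ z∈ys++zs with ∈-++⁻ ys z∈ys++zs
  ...   | inj₁ z∈ys = ∈-++⁺ʳ xs z∈ys
  ...   | inj₂ z∈zs = ∈-++⁺ˡ (zs⊆xs z∈zs)
  from : z ∈ xs ++ ys → z ∈ xs ++ ys ++ zs
  from z∈ = subst (z ∈_) (++-assoc xs ys zs) (∈-++⁺ˡ z∈)

length-deduplicate-set : ∀ {A : Set} (_≟_ : DecidableEquality A) xs {ys} → Unique ys →
  (∀ {z} → z ∈ xs ⇔ z ∈ ys) → length (deduplicate _≟_ xs) ≡ length ys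
length-deduplicate-set _≟_ xs ys-unique same =
  ↭-length (∼bag⇒↭ (unique∧set⇒bag (UniqueDecP.deduplicate-! _≟_ xs) ys-unique
    (mk⇔ (λ z∈ → Equivalence.to same (Equivalence.from (deduplicate-∈⇔ _≟_ {xs}) z∈))
         (λ z∈ → Equivalence.to (deduplicate-∈⇔ _≟_ {xs}) (Equivalence.from same z∈)))))

ascending : ℕ → ℕ → List ℕ
ascending t zero    = []
ascending t (suc c) = t ∷ ascending (suc t) c

descending : ℕ → ℕ → List ℕ
descending lo zero    = []
descending lo (suc c) = lo + c ∷ descending lo c

applyUpTo-ascending : ∀ n (f : ℕ → ℕ) t → (∀ x → f x ≡ t + x) → applyUpTo f n ≡ ascending t n
applyUpTo-ascending zero    f t f≡ = refl
applyUpTo-ascending (suc n) f t f≡ =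
  cong₂ _∷_ (trans (f≡ 0) (+-identityʳ t))
            (applyUpTo-ascending n (f ∘ suc) (suc t) (λ x → trans (f≡ (suc x)) (+-suc t x)))

rows-ascending : ∀ r → rows r ≡ ascending 1 r
rows-ascending r = trans (map-applyUpTo id suc r) (applyUpTo-ascending r suc 1 (λ x → refl))

ascending-++ : ∀ t a b → ascending t (a + b) ≡ ascending t a ++ ascending (t + a) b
ascending-++ t zero    b = cong (λ s → ascending s b) (sym (+-identityʳ t))
ascending-++ t (suc a) b =
  cong (t ∷_) (trans (ascending-++ (suc t) a b) (cong (λ s → ascending (suc t) a ++ ascending s b) (sym (+-suc t a))))

∈-ascending⁻ : ∀ {x} t c → x ∈ ascending t c → t ≤ x × x < t + c
∈-ascending⁻ t (suc c) (here refl) = ≤-refl , m<m+n t z<s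
∈-ascending⁻ {x} t (suc c) (there x∈) with ∈-ascending⁻ (suc t) c x∈
... | t<x , x<t+c = <⇒≤ t<x , subst (x <_) (sym (+-suc t c)) x<t+c

∈-ascending⁺ : ∀ {x} t c → t ≤ x → x < t + c → x ∈ ascending t c
∈-ascending⁺ {x} t zero    t≤x x<t+0 = ⊥-elim (<⇒≱ x<t+0 (≤-trans (≤-reflexive (+-identityʳ t)) t≤x))
∈-ascending⁺ {x} t (suc c) t≤x x<t+c with m≤n⇒m<n∨m≡n t≤x
... | inj₂ refl = here refl
... | inj₁ t<x  = there (∈-ascending⁺ (suc t) c t<x (subst (x <_) (+-suc t c) x<t+c))

rangeDown-descending : ∀ hi lo → rangeDown hi lo ≡ descending lo (suc hi ∸ lo)
rangeDown-descending hi lo =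
  trans (cong (map (lo +_)) (reverse-applyUpTo id (suc hi ∸ lo))) (shift-downFrom (suc hi ∸ lo))
  where
  shift-downFrom : ∀ c → map (lo +_) (applyDownFrom id c) ≡ descending lo c
  shift-downFrom zero    = refl
  shift-downFrom (suc c) = cong (lo + c ∷_) (shift-downFrom c)

∈-descending⁻ : ∀ {x} lo c → x ∈ descending lo c → lo ≤ x × x < lo + c
∈-descending⁻ lo (suc c) (here refl) = m≤m+n lo c , +-monoʳ-< lo ≤-refl
∈-descending⁻ lo (suc c) (there x∈) with ∈-descending⁻ lo c x∈
... | lo≤x , x<lo+c = lo≤x , <-trans x<lo+c (+-monoʳ-< lo ≤-refl)

descending-sorted : ∀ lo c → AllPairs (λ a b → b < a) (descending lo c)
descending-sorted lo zero    = []
descending-sorted lo (suc c) = All.tabulate (proj₂ ∘ ∈-descending⁻ lo c) ∷ descending-sorted lo c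

descending-++ : ∀ lo a b → descending lo (a + b) ≡ descending (lo + b) a ++ descending lo b
descending-++ lo zero    b = refl
descending-++ lo (suc a) b =
  cong₂ _∷_ (trans (cong (lo +_) (+-comm a b)) (sym (+-assoc lo b a))) (descending-++ lo a b)

length-descending : ∀ lo c → length (descending lo c) ≡ c
length-descending lo zero    = refl
length-descending lo (suc c) = cong suc (length-descending lo c)

below-range-top : ∀ {lo hi j} → lo ≤ j → j < lo + (suc hi ∸ lo) → j ≤ hi
below-range-top {lo} {hi} {j} lo≤j j<top with lo ≤? suc hi
... | yes lo≤ = ≤-pred (subst (j <_) (m+[n∸m]≡n lo≤) j<top)
... | no  lo≰ = ⊥-elim (<⇒≱ (subst (j <_) empty j<top) lo≤j)
  where
  empty : lo + (suc hi ∸ lo) ≡ lo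
  empty = trans (cong (lo +_) (m≤n⇒m∸n≡0 (<⇒≤ (≰⇒> lo≰)))) (+-identityʳ lo)

part-step-list : ∀ xs → Linked (λ a b → b ≤ a) xs → ∀ i → part xs (suc (suc i)) ≤ part xs (suc i)
part-step-list []           _               i       = z≤n
part-step-list (x ∷ [])     _               i       = z≤n
part-step-list (x ∷ y ∷ xs) (y≤x ∷ _)       zero    = y≤x
part-step-list (x ∷ y ∷ xs) (_ ∷ decreasing) (suc i) = part-step-list (y ∷ xs) decreasing i

part-positive-list : ∀ xs → All (λ a → 1 ≤ a) xs → ∀ {i} → i < length xs → 1 ≤ part xs (suc i)
part-positive-list (x ∷ xs) (1≤x ∷ _)   {zero}  _         = 1≤x
part-positive-list (x ∷ xs) (_ ∷ 1≤xs) {suc i} (s≤s i<ℓ) = part-positive-list xs 1≤xs i<ℓ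

part-beyond-list : ∀ xs {i} → length xs ≤ i → part xs (suc i) ≡ 0
part-beyond-list []       _         = refl
part-beyond-list (x ∷ xs) (s≤s ℓ≤i) = part-beyond-list xs ℓ≤i

part-applyUpTo : ∀ (h : ℕ → ℕ) n i → i < n → part (applyUpTo h n) (suc i) ≡ h i
part-applyUpTo h (suc n) zero    _         = refl
part-applyUpTo h (suc n) (suc i) (s≤s i<n) = part-applyUpTo (h ∘ suc) n i i<n

module LargestSatisfying {Q : ℕ → Set} (Q? : Decidable Q) where

  largest : List ℕ → ℕ
  largest = foldr (λ i acc → if ⌊ Q? i ⌋ then i ⊔ acc else acc) 0

  largest-≥ : ∀ {x} ys → x ∈ ys → Q x → x ≤ largest ys
  largest-≥ (y ∷ ys) (here refl) qx with Q? y
  ... | yes _  = m≤m⊔n y _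
  ... | no ¬qy = ⊥-elim (¬qy qx)
  largest-≥ (y ∷ ys) (there x∈) qx with Q? y
  ... | yes _ = ≤-trans (largest-≥ ys x∈ qx) (m≤n⊔m y _)
  ... | no _  = largest-≥ ys x∈ qx

  largest-attained : ∀ ys → largest ys ≡ 0 ⊎ (largest ys ∈ ys × Q (largest ys))
  largest-attained [] = inj₁ refl
  largest-attained (y ∷ ys) with Q? y
  ... | no _ = later (largest-attained ys)
    where
    later : largest ys ≡ 0 ⊎ (largest ys ∈ ys × Q (largest ys)) →
            largest ys ≡ 0 ⊎ (largest ys ∈ y ∷ ys × Q (largest ys))
    later (inj₁ ≡0)         = inj₁ ≡0
    later (inj₂ (∈ys , q)) = inj₂ (there ∈ys , q)
  ... | yes qy with ⊔-sel y (largest ys)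
  ...   | inj₁ eq rewrite eq = inj₂ (here refl , qy)
  ...   | inj₂ eq rewrite eq with largest-attained ys
  ...     | inj₁ ≡0         = inj₁ ≡0
  ...     | inj₂ (∈ys , q) = inj₂ (there ∈ys , q)

Above Below OnDiagonal : Node → Set
Above      x = proj₁ x < proj₂ x
Below      x = proj₂ x < proj₁ x
OnDiagonal x = proj₁ x ≡ proj₂ x

up? : (x : Node) → Dec (proj₁ x ≤ proj₂ x)
up? x = proj₁ x ≤? proj₂ x

filter-up-split : ∀ {k} before after → All Above before → All Below after →
  filter up? (before ++ (k , k) ∷ after) ≡ before ++ [ (k , k) ]
filter-up-split {k} before after before-above after-below =
  trans (filter-++ up? before _)
        (cong₂ _++_ (filter-all up? (All.map <⇒≤ before-above))
                    (trans (filter-accept up? {(k , k)} ≤-refl)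
                           (cong ((k , k) ∷_) (filter-none up? (All.map <⇒≱ after-below)))))

-- x ≺ y: y lies strictly further along the rim (towards the bottom-left).
_≺_ : Node → Node → Set
(i , j) ≺ (i′ , j′) = i + j′ < i′ + j

≺-trans : ∀ {x y z} → x ≺ y → y ≺ z → x ≺ z
≺-trans {i , j} {i′ , j′} {i″ , j″} x≺y y≺z =
  +-cancelʳ-< (i′ + j′) (i + j″) (i″ + j)
    (subst₂ _<_ (rearrange₁ i j′ i′ j″) (rearrange₂ i′ j i″ j′) (+-mono-< x≺y y≺z))
  where
  rearrange₁ : ∀ i j′ i′ j″ → (i + j′) + (i′ + j″) ≡ (i + j″) + (i′ + j′)
  rearrange₁ = solve-∀
  rearrange₂ : ∀ i′ j i″ j′ → (i′ + j) + (i″ + j′) ≡ (i″ + j) + (i′ + j′)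
  rearrange₂ = solve-∀

≺-irrefl : ∀ {x} → ¬ (x ≺ x)
≺-irrefl {i , j} = <-irrefl refl

sorted⇒unique : ∀ {xs} → AllPairs _≺_ xs → Unique xs
sorted⇒unique = AllPairs.map (λ {x} x≺y x≡y → ≺-irrefl {x} (subst (x ≺_) (sym x≡y) x≺y))

module Partition (λs : List ℕ) (isP : IsPartition λs) where

  ℓ : ℕ
  ℓ = length λs

  P : ℕ → ℕ
  P = part λs

  k : ℕ
  k = kOf λs

  part-positive : ∀ {i} → i < ℓ → 1 ≤ P (suc i)
  part-positive = part-positive-list λs (proj₂ isP)

  part-beyond : ∀ {i} → ℓ < i → P i ≡ 0
  part-beyond {suc i} (s≤s ℓ≤i) = part-beyond-list λs ℓ≤i

  part-antitone : ∀ {a b} → 1 ≤ a → a ≤ b → P b ≤ P a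
  part-antitone 1≤a a≤b = go 1≤a (≤⇒≤′ a≤b)
    where
    step : ∀ {n} → 1 ≤ n → P (suc n) ≤ P n
    step {suc n} _ = part-step-list λs (proj₁ isP) n
    go : ∀ {a b} → 1 ≤ a → a ≤′ b → P b ≤ P a
    go _   ≤′-refl          = ≤-refl
    go 1≤a (≤′-step a≤′n) = ≤-trans (step (≤-trans 1≤a (≤′⇒≤ a≤′n))) (go 1≤a a≤′n)

  conjPart-selfConjugate : SelfConjugate λs → ∀ t → t < P 1 → conjPart λs (suc t) ≡ P (suc t)
  conjPart-selfConjugate sc t t<λ₁ =
    begin
      conjPart λs (suc t)
    ≡⟨ sym (part-applyUpTo (λ j → conjPart λs (suc j)) (P 1) t t<λ₁) ⟩
      part (applyUpTo (λ j → conjPart λs (suc j)) (P 1)) (suc t)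
    ≡⟨ cong (λ xs → part xs (suc t)) (sym (map-applyUpTo id (λ j → conjPart λs (suc j)) (P 1))) ⟩
      part (conjugate λs) (suc t)
    ≡⟨ cong (λ xs → part xs (suc t)) sc ⟩
      P (suc t)
    ∎
    where open ≡-Reasoning

  open LargestSatisfying (λ i → i ≤? P i)

  k-maximal : ∀ {i} → 1 ≤ i → i ≤ ℓ → i ≤ P i → i ≤ k
  k-maximal {i} 1≤i i≤ℓ =
    largest-≥ (rows ℓ) (subst (i ∈_) (sym (rows-ascending ℓ)) (∈-ascending⁺ 1 ℓ 1≤i (s≤s i≤ℓ)))

  k-cases : k ≡ 0 ⊎ (1 ≤ k × k ≤ ℓ × k ≤ P k)
  k-cases with largest-attained (rows ℓ)
  ... | inj₁ k≡0 = inj₁ k≡0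
  ... | inj₂ (k∈ , k≤Pk) with ∈-ascending⁻ 1 ℓ (subst (k ∈_) (rows-ascending ℓ) k∈)
  ...   | 1≤k , s≤s k≤ℓ = inj₂ (1≤k , k≤ℓ , k≤Pk)

  part-below-k : ∀ {i} → k < i → P i < i
  part-below-k {i} k<i with i ≤? ℓ
  ... | no i≰ℓ = subst (_< i) (sym (part-beyond (≰⇒> i≰ℓ))) (≤-trans z<s k<i)
  ... | yes i≤ℓ with i ≤? P i
  ...   | yes i≤Pi = ⊥-elim (<⇒≱ k<i (k-maximal (≤-trans z<s k<i) i≤ℓ i≤Pi))
  ...   | no  i≰Pi = ≰⇒> i≰Pi

  InRimFrom : ℕ → Node → Set
  InRimFrom t (i , j) = t ≤ i × P (suc i) ≤ j × j ≤ P i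

  InRimFrom-weaken : ∀ {t t′ x} → t ≤ t′ → InRimFrom t′ x → InRimFrom t x
  InRimFrom-weaken {x = i , j} t≤t′ (t′≤i , rest) = ≤-trans t≤t′ t′≤i , rest

  ∈-rimRow : ∀ {x} i → x ∈ rimRow λs i → ∃ λ j → x ≡ (i , j) × P (suc i) ⊔ 1 ≤ j × j ≤ P i
  ∈-rimRow i x∈ with ∈-map⁻ (i ,_) x∈
  ... | j , j∈ , refl with ∈-descending⁻ _ _ (subst (j ∈_) (rangeDown-descending (P i) _) j∈)
  ...   | lo≤j , j<top = j , refl , lo≤j , below-range-top lo≤j j<top

  rimRow-inRim : ∀ {x} i → x ∈ rimRow λs i → InRimFrom i x
  rimRow-inRim i x∈ with ∈-rimRow i x∈
  ... | j , refl , lo≤j , j≤Pi = ≤-refl , ≤-trans (m≤m⊔n _ 1) lo≤j , j≤Pi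

  rimRow-sorted : ∀ i → AllPairs _≺_ (rimRow λs i)
  rimRow-sorted i =
    subst (λ js → AllPairs _≺_ (map (i ,_) js)) (sym (rangeDown-descending (P i) _))
      (AllPairsP.map⁺ (AllPairs.map (+-monoʳ-< i) (descending-sorted _ _)))

  ≺-later-row : ∀ {i j y} → P (suc i) ≤ j → InRimFrom (suc i) y → (i , j) ≺ y
  ≺-later-row {y = i′ , j′} λ₊≤j (i<i′ , _ , j′≤λ) =
    +-mono-<-≤ i<i′ (≤-trans j′≤λ (≤-trans (part-antitone (s≤s z≤n) i<i′) λ₊≤j))

  rimRows : ℕ → ℕ → List Node
  rimRows t c = concatMap (rimRow λs) (ascending t c)

  rimRows-++ : ∀ t a b → rimRows t (a + b) ≡ rimRows t a ++ rimRows (t + a) b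
  rimRows-++ t a b = trans (cong (concatMap (rimRow λs)) (ascending-++ t a b))
                           (concatMap-++ (rimRow λs) (ascending t a) (ascending (t + a) b))

  rimRows-inRim : ∀ c t → All (InRimFrom t) (rimRows t c)
  rimRows-inRim zero    t = []
  rimRows-inRim (suc c) t = AllP.++⁺ (All.tabulate (rimRow-inRim t))
                                     (All.map (InRimFrom-weaken (n≤1+n t)) (rimRows-inRim c (suc t)))

  rimRows-sorted : ∀ c t → AllPairs _≺_ (rimRows t c)
  rimRows-sorted zero    t = []
  rimRows-sorted (suc c) t =
    AllPairsP.++⁺ (rimRow-sorted t) (rimRows-sorted c (suc t))
      (All.tabulate (λ x∈ → All.map (row-t≺ x∈) (rimRows-inRim c (suc t))))
    where
    row-t≺ : ∀ {x y} → x ∈ rimRow λs t → InRimFrom (suc t) y → x ≺ y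
    row-t≺ x∈ y-in with ∈-rimRow t x∈
    ... | j , refl , lo≤j , _ = ≺-later-row (≤-trans (m≤m⊔n _ 1) lo≤j) y-in

  rimRows-rows : ∀ c t → All (λ x → proj₁ x < t + c) (rimRows t c)
  rimRows-rows zero    t = []
  rimRows-rows (suc c) t =
    AllP.++⁺ (All.tabulate in-row-t)
             (All.map (λ {x} < → subst (proj₁ x <_) (sym (+-suc t c)) <) (rimRows-rows c (suc t)))
    where
    in-row-t : ∀ {x} → x ∈ rimRow λs t → proj₁ x < t + suc c
    in-row-t x∈ with ∈-rimRow t x∈
    ... | j , refl , _ = m<m+n t z<s

  rimRow-length : ∀ {t} → 1 ≤ t → t < ℓ → length (rimRow λs t) + P (suc t) ≡ suc (P t)
  rimRow-length {t} 1≤t t<ℓ =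
    begin
      length (rimRow λs t) + P (suc t)
    ≡⟨ cong (_+ P (suc t)) (length-map (t ,_) (rangeDown (P t) lo)) ⟩
      length (rangeDown (P t) lo) + P (suc t)
    ≡⟨ cong (λ js → length js + P (suc t)) (rangeDown-descending (P t) lo) ⟩
      length (descending lo (suc (P t) ∸ lo)) + P (suc t)
    ≡⟨ cong (_+ P (suc t)) (length-descending lo _) ⟩
      (suc (P t) ∸ lo) + P (suc t)
    ≡⟨ cong (λ l → (suc (P t) ∸ l) + P (suc t)) (m≥n⇒m⊔n≡m (part-positive t<ℓ)) ⟩
      (suc (P t) ∸ P (suc t)) + P (suc t)
    ≡⟨ m∸n+n≡m (m≤n⇒m≤1+n (part-antitone 1≤t (n≤1+n t))) ⟩
      suc (P t)
    ∎
    where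
    open ≡-Reasoning
    lo : ℕ
    lo = P (suc t) ⊔ 1

  -- Telescoping: rows t, …, t+c−1 of the rim have λ_t − λ_{t+c} + c nodes.
  rimRows-length : ∀ c t → 1 ≤ t → t + c ≤ ℓ → length (rimRows t c) + P (t + c) ≡ P t + c
  rimRows-length zero    t _   _ = trans (cong P (+-identityʳ t)) (sym (+-identityʳ _))
  rimRows-length (suc c) t 1≤t t+c≤ℓ =
    begin
      length (rimRow λs t ++ rimRows (suc t) c) + P (t + suc c)
    ≡⟨ cong₂ _+_ (length-++ (rimRow λs t)) (cong P (+-suc t c)) ⟩
      (length (rimRow λs t) + length (rimRows (suc t) c)) + P (suc t + c)
    ≡⟨ +-assoc (length (rimRow λs t)) _ _ ⟩
      length (rimRow λs t) + (length (rimRows (suc t) c) + P (suc t + c))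
    ≡⟨ cong (length (rimRow λs t) +_) (rimRows-length c (suc t) (s≤s z≤n) (subst (_≤ ℓ) (+-suc t c) t+c≤ℓ)) ⟩
      length (rimRow λs t) + (P (suc t) + c)
    ≡⟨ sym (+-assoc (length (rimRow λs t)) _ _) ⟩
      (length (rimRow λs t) + P (suc t)) + c
    ≡⟨ cong (_+ c) (rimRow-length 1≤t (≤-trans (s≤s (m≤m+n t c)) (subst (_≤ ℓ) (+-suc t c) t+c≤ℓ))) ⟩
      suc (P t) + c
    ≡⟨ sym (+-suc (P t) c) ⟩
      P t + suc c
    ∎
    where open ≡-Reasoning

  rimFrom : ℕ → List Node
  rimFrom t = rimRows t (suc ℓ ∸ t)

  rimFrom-inRim : ∀ t → All (InRimFrom t) (rimFrom t)
  rimFrom-inRim t = rimRows-inRim (suc ℓ ∸ t) t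

  rimFrom-sorted : ∀ t → AllPairs _≺_ (rimFrom t)
  rimFrom-sorted t = rimRows-sorted (suc ℓ ∸ t) t

  rim-drop : ∀ t → 1 ≤ t → t ≤ suc ℓ → drop (firstLabel λs t ∸ 1) (rim λs) ≡ rimFrom t
  rim-drop (suc t) _ (s≤s t≤ℓ) =
    begin
      drop (length (concatMap (rimRow λs) (rows t))) (concatMap (rimRow λs) (rows ℓ))
    ≡⟨ cong₂ (λ a b → drop (length (concatMap (rimRow λs) a)) (concatMap (rimRow λs) b)) (rows-ascending t) rows-split ⟩
      drop (length (rimRows 1 t)) (rimRows 1 (t + (ℓ ∸ t)))
    ≡⟨ cong (drop (length (rimRows 1 t))) (rimRows-++ 1 t (ℓ ∸ t)) ⟩
      drop (length (rimRows 1 t)) (rimRows 1 t ++ rimRows (suc t) (ℓ ∸ t))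
    ≡⟨ drop-length-++ (rimRows 1 t) _ ⟩
      rimFrom (suc t)
    ∎
    where
    open ≡-Reasoning
    rows-split : rows ℓ ≡ ascending 1 (t + (ℓ ∸ t))
    rows-split = trans (rows-ascending ℓ) (cong (ascending 1) (sym (m+[n∸m]≡n t≤ℓ)))

  segment-rimFrom : ∀ p t → 1 ≤ t → t ≤ suc ℓ → segment p λs (firstLabel λs t) ≡ take p (rimFrom t)
  segment-rimFrom p t 1≤t t≤ = cong (take p) (rim-drop t 1≤t t≤)

  -- When k ≥ 1, the rim meets the diagonal exactly at (k,k).
  module Diagonal (1≤k : 1 ≤ k) (k≤ℓ : k ≤ ℓ) (k≤Pk : k ≤ P k) where

    lo : ℕ
    lo = P (suc k) ⊔ 1

    lo≤k : lo ≤ k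
    lo≤k = ⊔-lub (≤-pred (part-below-k ≤-refl)) 1≤k

    right left : List Node
    right = map (k ,_) (descending (suc k) (P k ∸ k))
    left  = map (k ,_) (descending lo (k ∸ lo))

    rimRow-k : rimRow λs k ≡ right ++ (k , k) ∷ left
    rimRow-k =
      begin
        map (k ,_) (rangeDown (P k) lo)
      ≡⟨ cong (map (k ,_)) (trans (rangeDown-descending (P k) lo) (cong (descending lo) size)) ⟩
        map (k ,_) (descending lo ((P k ∸ k) + suc (k ∸ lo)))
      ≡⟨ cong (map (k ,_)) (descending-++ lo (P k ∸ k) (suc (k ∸ lo))) ⟩
        map (k ,_) (descending (lo + suc (k ∸ lo)) (P k ∸ k) ++ (lo + (k ∸ lo)) ∷ descending lo (k ∸ lo))
      ≡⟨ cong₂ (λ a b → map (k ,_) (descending a (P k ∸ k) ++ b ∷ descending lo (k ∸ lo)))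
               (trans (+-suc lo (k ∸ lo)) (cong suc lo+≡k)) lo+≡k ⟩
        map (k ,_) (descending (suc k) (P k ∸ k) ++ k ∷ descending lo (k ∸ lo))
      ≡⟨ map-++ (k ,_) (descending (suc k) (P k ∸ k)) _ ⟩
        right ++ (k , k) ∷ left
      ∎
      where
      open ≡-Reasoning
      lo+≡k : lo + (k ∸ lo) ≡ k
      lo+≡k = m+[n∸m]≡n lo≤k
      size : suc (P k) ∸ lo ≡ (P k ∸ k) + suc (k ∸ lo)
      size =
        begin
          suc (P k) ∸ lo
        ≡⟨ cong (λ n → suc n ∸ lo) (sym (m∸n+n≡m k≤Pk)) ⟩
          suc ((P k ∸ k) + k) ∸ lo
        ≡⟨ +-∸-assoc (suc (P k ∸ k)) lo≤k ⟩
          suc (P k ∸ k) + (k ∸ lo)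
        ≡⟨ sym (+-suc (P k ∸ k) (k ∸ lo)) ⟩
          (P k ∸ k) + suc (k ∸ lo)
        ∎

    right-above : All Above right
    right-above = AllP.map⁺ (All.tabulate (λ j∈ → proj₁ (∈-descending⁻ (suc k) _ j∈)))

    left-below : All (λ x → Below x × k ≤ proj₁ x) left
    left-below = AllP.map⁺ (All.tabulate (λ j∈ → subst (_ <_) (m+[n∸m]≡n lo≤k) (proj₂ (∈-descending⁻ lo _ j∈)) , ≤-refl))

    -- Rows i > k lie strictly below the diagonal: j ≤ λ_i < i.
    lower-below : All (λ x → Below x × k ≤ proj₁ x) (rimFrom (suc k))
    lower-below = All.map below (rimFrom-inRim (suc k))
      where
      below : ∀ {x} → InRimFrom (suc k) x → Below x × k ≤ proj₁ x
      below {i , j} (k<i , _ , j≤λ) = ≤-<-trans j≤λ (part-below-k k<i) , <⇒≤ k<i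

    -- Rows t, …, k−1 lie strictly above the diagonal: j ≥ λ_{i+1} ≥ λ_k ≥ k > i.
    rows-before-k-above : ∀ t → t ≤ k → All Above (rimRows t (k ∸ t))
    rows-before-k-above t t≤k = All.map above (All.zip (rimRows-inRim (k ∸ t) t , rimRows-rows (k ∸ t) t))
      where
      above : ∀ {x} → InRimFrom t x × proj₁ x < t + (k ∸ t) → Above x
      above {i , j} ((_ , λ₊≤j , _) , i<t+d) =
        let i<k = subst (i <_) (m+[n∸m]≡n t≤k) i<t+d in
        ≤-trans (≤-trans i<k k≤Pk) (≤-trans (part-antitone (s≤s z≤n) i<k) λ₊≤j)

    rimFrom-through-k : ∀ t → t ≤ k →
      rimFrom t ≡ (rimRows t (k ∸ t) ++ right) ++ (k , k) ∷ (left ++ rimFrom (suc k))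
    rimFrom-through-k t t≤k =
      begin
        rimFrom t
      ≡⟨ cong (rimRows t) rows-count ⟩
        rimRows t (d + suc (ℓ ∸ k))
      ≡⟨ rimRows-++ t d (suc (ℓ ∸ k)) ⟩
        rimRows t d ++ rimRows (t + d) (suc (ℓ ∸ k))
      ≡⟨ cong (λ s → rimRows t d ++ rimRows s (suc (ℓ ∸ k))) (m+[n∸m]≡n t≤k) ⟩
        rimRows t d ++ (rimRow λs k ++ rimFrom (suc k))
      ≡⟨ cong (λ r → rimRows t d ++ (r ++ rimFrom (suc k))) rimRow-k ⟩
        rimRows t d ++ ((right ++ (k , k) ∷ left) ++ rimFrom (suc k))
      ≡⟨ cong (rimRows t d ++_) (++-assoc right ((k , k) ∷ left) (rimFrom (suc k))) ⟩
        rimRows t d ++ (right ++ (k , k) ∷ (left ++ rimFrom (suc k)))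
      ≡⟨ sym (++-assoc (rimRows t d) right _) ⟩
        (rimRows t d ++ right) ++ (k , k) ∷ (left ++ rimFrom (suc k))
      ∎
      where
      open ≡-Reasoning
      d : ℕ
      d = k ∸ t
      rows-count : suc ℓ ∸ t ≡ d + suc (ℓ ∸ k)
      rows-count =
        begin
          suc ℓ ∸ t
        ≡⟨ cong (λ n → suc n ∸ t) (sym (m∸n+n≡m k≤ℓ)) ⟩
          suc ((ℓ ∸ k) + k) ∸ t
        ≡⟨ +-∸-assoc (suc (ℓ ∸ k)) t≤k ⟩
          suc (ℓ ∸ k) + d
        ≡⟨ +-comm (suc (ℓ ∸ k)) d ⟩
          d + suc (ℓ ∸ k)
        ∎

    -- Before (k,k) the rim from row t has λ_t − t nodes: |rows t..k−1| + λ_k = λ_t + (k − t)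
    -- and |right| = λ_k − k.
    before-k-length : ∀ t → 1 ≤ t → t ≤ k → length (rimRows t (k ∸ t) ++ right) + t ≡ P t
    before-k-length t 1≤t t≤k = +-cancelʳ-≡ d _ _ (
      begin
        length (rimRows t d ++ right) + t + d
      ≡⟨ cong (λ n → n + t + d) (trans (length-++ (rimRows t d)) (cong (a +_) length-right)) ⟩
        a + (P k ∸ k) + t + d
      ≡⟨ regroup a (P k ∸ k) t d ⟩
        a + ((t + d) + (P k ∸ k))
      ≡⟨ cong (λ s → a + (s + (P k ∸ k))) t+d≡k ⟩
        a + (k + (P k ∸ k))
      ≡⟨ cong (a +_) (m+[n∸m]≡n k≤Pk) ⟩
        a + P k
      ≡⟨ cong (λ s → a + P s) (sym t+d≡k) ⟩
        a + P (t + d)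
      ≡⟨ rimRows-length d t 1≤t (subst (_≤ ℓ) (sym t+d≡k) k≤ℓ) ⟩
        P t + d
      ∎)
      where
      open ≡-Reasoning
      d a : ℕ
      d = k ∸ t
      a = length (rimRows t d)
      t+d≡k : t + d ≡ k
      t+d≡k = m+[n∸m]≡n t≤k
      length-right : length right ≡ P k ∸ k
      length-right = trans (length-map (k ,_) (descending (suc k) (P k ∸ k))) (length-descending (suc k) (P k ∸ k))
      regroup : ∀ a e t d → a + e + t + d ≡ a + ((t + d) + e)
      regroup = solve-∀

    record DiagonalSplit (t : ℕ) : Set where
      field
        before after  : List Node
        splits        : rimFrom t ≡ before ++ (k , k) ∷ after
        before-above  : All Above before
        after-below   : All (λ x → Below x × k ≤ proj₁ x) after
        before-length : length before + t ≡ P t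

    rimFrom-split : ∀ t → 1 ≤ t → t ≤ k → DiagonalSplit t
    rimFrom-split t 1≤t t≤k = record
      { before        = rimRows t (k ∸ t) ++ right
      ; after         = left ++ rimFrom (suc k)
      ; splits        = rimFrom-through-k t t≤k
      ; before-above  = AllP.++⁺ (rows-before-k-above t t≤k) right-above
      ; after-below   = AllP.++⁺ left-below lower-below
      ; before-length = before-k-length t 1≤t t≤k
      }

    hook-diagonal : SelfConjugate λs → ∀ {t} L → 1 ≤ t → t ≤ k → L + t ≡ P t → hook λs t t ≡ suc (L + L)
    hook-diagonal sc {suc t} L _ t<k L+t≡Pt =
      begin
        (P (suc t) + conjPart λs (suc t) + 1) ∸ (suc t + suc t)
      ≡⟨ cong (λ c → (P (suc t) + c + 1) ∸ (suc t + suc t)) (conjPart-selfConjugate sc t t<λ₁) ⟩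
        (P (suc t) + P (suc t) + 1) ∸ (suc t + suc t)
      ≡⟨ cong (λ n → (n + n + 1) ∸ (suc t + suc t)) (sym L+t≡Pt) ⟩
        (L + suc t + (L + suc t) + 1) ∸ (suc t + suc t)
      ≡⟨ cong (_∸ (suc t + suc t)) (regroup L (suc t)) ⟩
        (suc (L + L) + (suc t + suc t)) ∸ (suc t + suc t)
      ≡⟨ m+n∸n≡m (suc (L + L)) (suc t + suc t) ⟩
        suc (L + L)
      ∎
      where
      open ≡-Reasoning
      t<λ₁ : t < P 1
      t<λ₁ = ≤-trans t<k (≤-trans k≤Pk (part-antitone ≤-refl 1≤k))
      regroup : ∀ L s → L + s + (L + s) + 1 ≡ suc (L + L) + (s + s)
      regroup = solve-∀

module Segments (p : ℕ) (λs : List ℕ) (isP : IsPartition λs) where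
  open Partition λs isP

  segmentsFromRow : ℕ → ℕ → List Node
  segmentsFromRow f t = segmentsFrom p λs f (firstLabel λs t)

  firstSegment : ℕ → List Node
  firstSegment t = segment p λs (firstLabel λs t)

  continuation : ℕ → Maybe Node → List Node
  continuation f nothing        = []
  continuation f (just (i , _)) = if ⌊ i <? ℓ ⌋ then segmentsFromRow f (suc i) else []

  segmentsFromRow-unfold : ∀ f t → segmentsFromRow (suc f) t ≡ firstSegment t ++ continuation f (last (firstSegment t))
  segmentsFromRow-unfold f t with last (firstSegment t)
  ... | nothing      = sym (++-identityʳ _)
  ... | just (i , _) with i <? ℓ
  ...   | yes _ = refl
  ...   | no _  = sym (++-identityʳ _)

  segmentsFromRow-inRim : ∀ f t → 1 ≤ t → t ≤ suc ℓ →
    All (InRimFrom t) (segmentsFromRow f t) × AllPairs _≺_ (segmentsFromRow f t)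
  segmentsFromRow-inRim zero    t _   _  = [] , []
  segmentsFromRow-inRim (suc f) t 1≤t t≤ =
    subst (λ xs → All (InRimFrom t) xs × AllPairs _≺_ xs) (sym (segmentsFromRow-unfold f t))
          (with-continuation (last S) refl)
    where
    S : List Node
    S = firstSegment t
    S-inRim : All (InRimFrom t) S
    S-inRim = subst (All (InRimFrom t)) (sym (segment-rimFrom p t 1≤t t≤)) (AllP.take⁺ p (rimFrom-inRim t))
    S-sorted : AllPairs _≺_ S
    S-sorted = subst (AllPairs _≺_) (sym (segment-rimFrom p t 1≤t t≤)) (AllPairsP.take⁺ p (rimFrom-sorted t))

    with-continuation : ∀ m → last S ≡ m →
      All (InRimFrom t) (S ++ continuation f m) × AllPairs _≺_ (S ++ continuation f m)
    with-continuation nothing _ =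
      AllP.++⁺ S-inRim [] , AllPairsP.++⁺ S-sorted [] (All.tabulate (λ _ → []))
    with-continuation (just (i , j)) last≡ with i <? ℓ
    ... | no _ = AllP.++⁺ S-inRim [] , AllPairsP.++⁺ S-sorted [] (All.tabulate (λ _ → []))
    ... | yes i<ℓ with segmentsFromRow-inRim f (suc i) (s≤s z≤n) (m≤n⇒m≤1+n i<ℓ)
    ...   | C-inRim , C-sorted =
      AllP.++⁺ S-inRim (All.map (InRimFrom-weaken (m≤n⇒m≤1+n t≤i)) C-inRim) ,
      AllPairsP.++⁺ S-sorted C-sorted (All.tabulate (λ x∈S → All.map (S≺C x∈S) C-inRim))
      where
      ij-inRim : InRimFrom t (i , j)
      ij-inRim = All.lookup S-inRim (last-∈ S last≡)
      t≤i : t ≤ i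
      t≤i = proj₁ ij-inRim
      S≺C : ∀ {x y} → x ∈ S → InRimFrom (suc i) y → x ≺ y
      S≺C {x} {y} x∈S y-in with last-sorted S S-sorted last≡ x∈S
      ... | inj₁ refl = ≺-later-row (proj₁ (proj₂ ij-inRim)) y-in
      ... | inj₂ x≺ij = ≺-trans {x} {i , j} {y} x≺ij (≺-later-row (proj₁ (proj₂ ij-inRim)) y-in)

  upperFromRow : ℕ → ℕ → List Node
  upperFromRow f t = filter up? (segmentsFromRow f t)

  upper-beyond-k : ∀ f t → 1 ≤ t → t ≤ suc ℓ → k < t → upperFromRow f t ≡ []
  upper-beyond-k f t 1≤t t≤ k<t = filter-none up? (All.map below (proj₁ (segmentsFromRow-inRim f t 1≤t t≤)))
    where
    below : ∀ {x} → InRimFrom t x → ¬ (proj₁ x ≤ proj₂ x)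
    below {i , j} (t≤i , _ , j≤λ) i≤j = <⇒≱ (part-below-k (<-≤-trans k<t t≤i)) (≤-trans i≤j j≤λ)

  continuation-beyond-k : ∀ f m → (∀ x → m ≡ just x → k ≤ proj₁ x) → filter up? (continuation f m) ≡ []
  continuation-beyond-k f nothing        _     = refl
  continuation-beyond-k f (just (i , j)) k≤row with i <? ℓ
  ... | yes i<ℓ = upper-beyond-k f (suc i) (s≤s z≤n) (m≤n⇒m≤1+n i<ℓ) (s≤s (k≤row (i , j) refl))
  ... | no _    = refl

data UpperShape (p k : ℕ) (U : List Node) : Set where
  offDiagonal     : ∀ Y → U ≡ Y → All Above Y → p ∣ length Y → UpperShape p k U
  throughDiagonal : ∀ Y → U ≡ Y ++ [ (k , k) ] → 1 ≤ k → All Above Y →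
                    ¬ (p ∣ suc (length Y + length Y)) → UpperShape p k U

prepend-segment : ∀ {p k U} X → All Above X → length X ≡ p → UpperShape p k U → UpperShape p k (X ++ U)
prepend-segment X X-above refl (offDiagonal Y refl Y-above p∣Y) =
  offDiagonal (X ++ Y) refl (AllP.++⁺ X-above Y-above)
    (subst (length X ∣_) (sym (length-++ X)) (∣m∣n⇒∣m+n ∣-refl p∣Y))
prepend-segment X X-above refl (throughDiagonal Y refl 1≤k Y-above p∤) =
  throughDiagonal (X ++ Y) (sym (++-assoc X Y _)) 1≤k (AllP.++⁺ X-above Y-above) p∤′
  where
  shift : ∀ x L → suc ((x + L) + (x + L)) ≡ (x + x) + suc (L + L)
  shift = solve-∀
  p∤′ : ¬ (length X ∣ suc (length (X ++ Y) + length (X ++ Y)))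
  p∤′ p∣ = p∤ (∣m+n∣m⇒∣n (subst (length X ∣_) (trans (cong (λ n → suc (n + n)) (length-++ X)) (shift (length X) (length Y))) p∣)
                         (∣m∣n⇒∣m+n ∣-refl ∣-refl))

module UpperHalf (p : ℕ) (λs : List ℕ) (isP : IsPartition λs) (sc : SelfConjugate λs)
                 (bg : ∀ i → 1 ≤ i → i ≤ kOf λs → ¬ (p ∣ hook λs i i)) where
  open Partition λs isP
  open Segments p λs isP

  module _ (1≤k : 1 ≤ k) (k≤ℓ : k ≤ ℓ) (k≤Pk : k ≤ P k) where
    open Diagonal 1≤k k≤ℓ k≤Pk

    module FromRow (t : ℕ) (1≤t : 1 ≤ t) (t≤k : t ≤ k) where
      open DiagonalSplit (rimFrom-split t 1≤t t≤k) public

      segment≡ : firstSegment t ≡ take p (before ++ (k , k) ∷ after)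
      segment≡ = trans (segment-rimFrom p t 1≤t (≤-trans t≤k (m≤n⇒m≤1+n k≤ℓ))) (cong (take p) splits)

      segment-before-k : p ≤ length before → firstSegment t ≡ take p before
      segment-before-k p≤ = trans segment≡ (take-++ˡ p before _ p≤)

      segment-through-k : length before < p → firstSegment t ≡ before ++ (k , k) ∷ take (p ∸ suc (length before)) after
      segment-through-k <p = trans segment≡ (trans (take-++ʳ p before _ (<⇒≤ <p))
                                    (cong (λ n → before ++ take n ((k , k) ∷ after)) (+-∸-assoc 1 <p)))

      segment-through-k-ends : (<p : length before < p) → ∀ x → last (firstSegment t) ≡ just x → k ≤ proj₁ x
      segment-through-k-ends <p x last≡
        with last-++-∷ before (k , k) _ (trans (cong last (sym (segment-through-k <p))) last≡)
      ... | inj₁ refl = ≤-refl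
      ... | inj₂ x∈   = proj₂ (All.lookup (AllP.take⁺ _ after-below) x∈)

      -- 2(λ_t − t) + 1 = h_tt is prime to p, since λ is a BG-partition.
      before-hook : ¬ (p ∣ suc (length before + length before))
      before-hook p∣ = bg t 1≤t t≤k (subst (p ∣_) (sym (hook-diagonal sc (length before) 1≤t t≤k before-length)) p∣)

    empty : ∀ {U} → U ≡ [] → UpperShape p k U
    empty U≡[] = offDiagonal [] U≡[] [] (p ∣0)

    shape : ∀ f t → 1 ≤ t → t ≤ k → UpperShape p k (upperFromRow f t)
    shape-continuation : ∀ f m → UpperShape p k (filter up? (continuation f m))

    shape zero    t _   _   = empty refl
    shape (suc f) t 1≤t t≤k =
      subst (UpperShape p k) (sym upper≡) (by-length (p ≤? length before))
      where
      open FromRow t 1≤t t≤k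
      S : List Node
      S = firstSegment t
      upper≡ : upperFromRow (suc f) t ≡ filter up? S ++ filter up? (continuation f (last S))
      upper≡ = trans (cong (filter up?) (segmentsFromRow-unfold f t)) (filter-++ up? S _)

      by-length : Dec (p ≤ length before) → UpperShape p k (filter up? S ++ filter up? (continuation f (last S)))
      by-length (yes p≤) =
        subst (λ Z → UpperShape p k (Z ++ filter up? (continuation f (last S))))
              (sym (trans (cong (filter up?) (segment-before-k p≤)) (filter-all up? (All.map <⇒≤ X-above))))
              (prepend-segment (take p before) X-above (trans (length-take p before) (m≤n⇒m⊓n≡m p≤))
                               (shape-continuation f (last S)))
        where
        X-above : All Above (take p before)
        X-above = AllP.take⁺ p before-above
      by-length (no p≰) =
        throughDiagonal before (trans (cong₂ _++_ filter-S tail-empty) (++-identityʳ _)) 1≤k before-above before-hook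
        where
        filter-S : filter up? S ≡ before ++ [ (k , k) ]
        filter-S = trans (cong (filter up?) (segment-through-k (≰⇒> p≰)))
                         (filter-up-split before _ before-above (All.map proj₁ (AllP.take⁺ _ after-below)))
        tail-empty : filter up? (continuation f (last S)) ≡ []
        tail-empty = continuation-beyond-k f (last S) (segment-through-k-ends (≰⇒> p≰))

    shape-continuation f nothing = empty refl
    shape-continuation f (just (i , j)) with i <? ℓ
    ... | no _ = empty refl
    ... | yes i<ℓ with i <? k
    ...   | yes i<k = shape f (suc i) (s≤s z≤n) i<k
    ...   | no  i≮k = empty (upper-beyond-k f (suc i) (s≤s z≤n) (m≤n⇒m≤1+n i<ℓ) (s≤s (≮⇒≥ i≮k)))

  fuel : ℕ
  fuel = suc (length (rim λs))

  upper-shape : UpperShape p k (Uλ p λs)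
  upper-shape with k-cases
  ... | inj₁ k≡0 =
    offDiagonal [] (upper-beyond-k fuel 1 ≤-refl (s≤s z≤n) (subst (_< 1) (sym k≡0) z<s)) [] (p ∣0)
  ... | inj₂ (1≤k , k≤ℓ , k≤Pk) = shape 1≤k k≤ℓ k≤Pk fuel 1 ≤-refl 1≤k

  upper-unique : Unique (Uλ p λs)
  upper-unique = sorted⇒unique (AllPairsP.filter⁺ up? (proj₂ (segmentsFromRow-inRim fuel 1 ≤-refl (s≤s z≤n))))

Node-≟ : DecidableEquality Node
Node-≟ = ×-≡-dec _≟_ _≟_

mirror : List Node → List Node
mirror U = deduplicate Node-≟ (U ++ map swap U)

swap-injective : ∀ {x y : Node} → swap x ≡ swap y → x ≡ y
swap-injective {a , b} {c , d} refl = refl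

map-swap-diagonal : ∀ D → All OnDiagonal D → map swap D ≡ D
map-swap-diagonal []            []           = refl
map-swap-diagonal ((i , j) ∷ D) (refl ∷ on) = cong ((i , i) ∷_) (map-swap-diagonal D on)

mirror-⊇ : ∀ {U x} → x ∈ U → x ∈ mirror U
mirror-⊇ {U} x∈ = Equivalence.to (deduplicate-∈⇔ Node-≟ {U ++ map swap U}) (∈-++⁺ˡ x∈)

-- If U = Y ++ D, Y strictly above and D on the diagonal, then U ∪ Uᵀ
-- is the disjoint union of Y, D and Yᵀ.
mirror-length : ∀ {U} Y D → U ≡ Y ++ D → All Above Y → All OnDiagonal D → Unique U →
                length (mirror U) ≡ length D + (length Y + length Y)
mirror-length Y D refl Y-above D-on U-unique =
  begin
    length (mirror U)
  ≡⟨ length-deduplicate-set Node-≟ (U ++ map swap U) W-unique same-members ⟩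
    length (U ++ map swap Y)
  ≡⟨ length-++ U ⟩
    length U + length (map swap Y)
  ≡⟨ cong₂ _+_ (length-++ Y) (length-map swap Y) ⟩
    (length Y + length D) + length Y
  ≡⟨ regroup (length Y) (length D) ⟩
    length D + (length Y + length Y)
  ∎
  where
  open ≡-Reasoning
  U : List Node
  U = Y ++ D
  regroup : ∀ y d → (y + d) + y ≡ d + (y + y)
  regroup = solve-∀
  same-members : ∀ {z} → z ∈ U ++ map swap U ⇔ z ∈ U ++ map swap Y
  same-members {z} =
    subst (λ l → z ∈ U ++ l ⇔ z ∈ U ++ map swap Y)
          (sym (trans (map-++ swap Y D) (cong (map swap Y ++_) (map-swap-diagonal D D-on))))
          (∈-++-absorb U (map swap Y) D (∈-++⁺ʳ Y))
  U-weakly-above : All (λ x → proj₁ x ≤ proj₂ x) U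
  U-weakly-above = AllP.++⁺ (All.map <⇒≤ Y-above) (All.map ≤-reflexive D-on)
  Yᵀ-below : All Below (map swap Y)
  Yᵀ-below = AllP.map⁺ Y-above
  W-unique : Unique (U ++ map swap Y)
  W-unique = UniqueP.++⁺ U-unique (UniqueP.map⁺ swap-injective (AllPairs-++⁻ˡ Y U-unique))
               (λ (z∈U , z∈Yᵀ) → <⇒≱ (All.lookup Yᵀ-below z∈Yᵀ) (All.lookup U-weakly-above z∈U))

mirror-diagonal : ∀ {U i} Y D → U ≡ Y ++ D → All Above Y → (i , i) ∈ mirror U → (i , i) ∈ D
mirror-diagonal {U} {i} Y D refl Y-above ii∈ =
  from-U (in-U (∈-++⁻ U (Equivalence.from (deduplicate-∈⇔ Node-≟ {U ++ map swap U}) ii∈)))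
  where
  -- a diagonal node of Uᵀ is its own transpose, hence lies in U
  in-U : (i , i) ∈ U ⊎ (i , i) ∈ map swap U → (i , i) ∈ U
  in-U (inj₁ ii∈U) = ii∈U
  in-U (inj₂ ii∈Uᵀ) with ∈-map⁻ swap ii∈Uᵀ
  ... | (a , b) , ab∈U , refl = ab∈U
  from-U : (i , i) ∈ Y ++ D → (i , i) ∈ D
  from-U ii∈U with ∈-++⁻ Y ii∈U
  ... | inj₁ ii∈Y = ⊥-elim (<-irrefl refl (All.lookup Y-above ii∈Y))
  ... | inj₂ ii∈D = ii∈D

even : ∀ L → 2 ∣ L + L
even L = divides L (trans (cong (L +_) (sym (+-identityʳ L))) (*-comm 2 L))

odd : ∀ L → ¬ (2 ∣ suc (L + L))
odd L 2∣ with ∣1⇒≡1 (∣m+n∣m⇒∣n (subst (2 ∣_) (+-comm 1 (L + L)) 2∣) (even L))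
... | ()

AllOrNone : Set → Set → Set → Set
AllOrNone A B C = (A × B × C) ⊎ (¬ A × ¬ B × ¬ C)

all-or-none⇒equivalent : ∀ {A B C : Set} → AllOrNone A B C → (A ⇔ B) × (B ⇔ C)
all-or-none⇒equivalent (inj₁ (a , b , c))    = mk⇔ (λ _ → b) (λ _ → a) , mk⇔ (λ _ → c) (λ _ → b)
all-or-none⇒equivalent (inj₂ (¬a , ¬b , ¬c)) = mk⇔ (⊥-elim ∘ ¬a) (⊥-elim ∘ ¬b) , mk⇔ (⊥-elim ∘ ¬b) (⊥-elim ∘ ¬c)

rimStar-dichotomy : ∀ p λs → IsPartition λs → IsBG p λs →
  AllOrNone (2 ∣ aStar p λs) (NoDiagonal p λs) (p ∣ aStar p λs)
rimStar-dichotomy p λs isP (sc , bg) = by-shape upper-shape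
  where
  open UpperHalf p λs isP sc bg
  by-shape : UpperShape p (kOf λs) (Uλ p λs) → AllOrNone (2 ∣ aStar p λs) (NoDiagonal p λs) (p ∣ aStar p λs)
  by-shape (offDiagonal Y U≡Y Y-above p∣Y) =
    inj₁ (subst (2 ∣_) (sym size) (even (length Y)) , no-diagonal , subst (p ∣_) (sym size) (∣m∣n⇒∣m+n p∣Y p∣Y))
    where
    U≡Y++[] : Uλ p λs ≡ Y ++ []
    U≡Y++[] = trans U≡Y (sym (++-identityʳ Y))
    size : aStar p λs ≡ length Y + length Y
    size = mirror-length Y [] U≡Y++[] Y-above [] upper-unique
    no-diagonal : NoDiagonal p λs
    no-diagonal i _ _ ii∈ with mirror-diagonal Y [] U≡Y++[] Y-above ii∈
    ... | ()
  by-shape (throughDiagonal Y U≡ 1≤k Y-above p∤) =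
    inj₂ (odd (length Y) ∘ subst (2 ∣_) size , has-diagonal , p∤ ∘ subst (p ∣_) size)
    where
    size : aStar p λs ≡ suc (length Y + length Y)
    size = mirror-length Y [ _ ] U≡ Y-above (refl ∷ []) upper-unique
    has-diagonal : ¬ NoDiagonal p λs
    has-diagonal no-diag = no-diag (kOf λs) 1≤k ≤-refl (mirror-⊇ (subst (_ ∈_) (sym U≡) (∈-++⁺ʳ Y (here refl))))

corollary3p21 : (p : ℕ) → Prime p → ¬ (2 ∣ p) →
    (λs : List ℕ) → IsPartition λs → IsBG p λs →
    ((epsStar p λs ≡ 0) ⇔ (2 ∣ aStar p λs)) ×
    ((2 ∣ aStar p λs) ⇔ NoDiagonal p λs) ×
    (NoDiagonal p λs ⇔ (p ∣ aStar p λs))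
corollary3p21 p _ _ λs isP isBG =
  m%n≡0⇔n∣m (aStar p λs) 2 , all-or-none⇒equivalent (rimStar-dichotomy p λs isP isBG)
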